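{- Let $\Gamma=(V,E)$ be a reduced graph. Then $\mathrm{Aut}^{\mathrm{TF}}(\Gamma) \cong \mathrm{Aut}^{\pi}(\Gamma)$ and $$\mathrm{Aut}^{\pi}(\Gamma) = \{\pi_1 \in \mathrm{Sym}(V) \mid (\pi_1,\pi_2) \in \mathrm{Aut}^{\mathrm{TF}}(\Gamma) \text{ for some } \pi_2\in\mathrm{Sym}(V)\}.$$
   Context: Graphs are finite, simple, loopless; $N(v)=\{w:(v,w)\in E\}$; $\Gamma$ is reduced if $N(v)=N(w)$ implies $v=w$. $\mathrm{Aut}^{\pi}(\Gamma)$ is the group (under composition) of bijections $\pi:V\to V$ such that for every $v\in V$ there exists $w\in V$ with $\pi(N(v))=N(w)$. $\mathrm{Aut}^{\mathrm{TF}}(\Gamma)$ is the group, under coordinatewise composition, of pairs $(\pi_1,\pi_2)$ of permutations of $V$ such that for all $v,w\in V$: $(v,w)\in E \iff (\pi_1(v),\pi_2(w))\in E$. -}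

module Defs where

open import Level using (0ℓ)
open import Data.Nat using (ℕ)
open import Data.Fin using (Fin)
open import Data.Bool using (Bool; true; false)
open import Data.Product using (Σ; ∃; ∃-syntax; _×_; _,_; proj₁; proj₂)
open import Relation.Binary.PropositionalEquality using (_≡_)
open import Function.Bundles using (_⇔_)
open import Data.Fin.Permutation using (Permutation′; _⟨$⟩ʳ_) renaming (_≈_ to _≈ₚ_)

record Graph (n : ℕ) : Set where
  field
    adj   : Fin n → Fin n → Bool
    sym   : ∀ v w → adj v w ≡ adj w v
    irrefl : ∀ v → adj v v ≡ false
  E : Fin n → Fin n → Set
  E v w = adj v w ≡ true

open Graph public using (E)

Subset : ℕ → Set₁
Subset n = Fin n → Set

_≐_ : ∀ {n} → Subset n → Subset n → Set
S ≐ T = ∀ u → S u ⇔ T u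

image : ∀ {n} → Permutation′ n → Subset n → Subset n
image π S u = ∃[ x ] (S x × π ⟨$⟩ʳ x ≡ u)

N : ∀ {n} → Graph n → Fin n → Subset n
N Γ v w = E Γ v w

Reduced : ∀ {n} → Graph n → Set
Reduced Γ = ∀ v w → N Γ v ≐ N Γ w → v ≡ w

IsAutπ : ∀ {n} → Graph n → Permutation′ n → Set
IsAutπ Γ π = ∀ v → ∃[ w ] (image π (N Γ v) ≐ N Γ w)

IsAutTF : ∀ {n} → Graph n → Permutation′ n × Permutation′ n → Set
IsAutTF Γ (π₁ , π₂) = ∀ v w → E Γ v w ⇔ E Γ (π₁ ⟨$⟩ʳ v) (π₂ ⟨$⟩ʳ w)

Autπ : ∀ {n} → Graph n → Set
Autπ {n} Γ = Σ (Permutation′ n) (IsAutπ Γ)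

AutTF : ∀ {n} → Graph n → Set
AutTF {n} Γ = Σ (Permutation′ n × Permutation′ n) (IsAutTF Γ)

_≈π_ : ∀ {n} {Γ : Graph n} → Autπ Γ → Autπ Γ → Set
a ≈π b = proj₁ a ≈ₚ proj₁ b

_≈TF_ : ∀ {n} {Γ : Graph n} → AutTF Γ → AutTF Γ → Set
a ≈TF b = (proj₁ (proj₁ a) ≈ₚ proj₁ (proj₁ b)) × (proj₂ (proj₁ a) ≈ₚ proj₂ (proj₁ b))

-- "c is the product a ∘ b" in each group (group law = composition of maps,
-- coordinatewise for Aut^TF).  Stated relationally to avoid needing closure proofs.
IsProdπ : ∀ {n} {Γ : Graph n} → Autπ Γ → Autπ Γ → Autπ Γ → Set
IsProdπ c a b = ∀ x → proj₁ c ⟨$⟩ʳ x ≡ proj₁ a ⟨$⟩ʳ (proj₁ b ⟨$⟩ʳ x)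

IsProdTF : ∀ {n} {Γ : Graph n} → AutTF Γ → AutTF Γ → AutTF Γ → Set
IsProdTF c a b =
  (∀ x → proj₁ (proj₁ c) ⟨$⟩ʳ x ≡ proj₁ (proj₁ a) ⟨$⟩ʳ (proj₁ (proj₁ b) ⟨$⟩ʳ x)) ×
  (∀ x → proj₂ (proj₁ c) ⟨$⟩ʳ x ≡ proj₂ (proj₁ a) ⟨$⟩ʳ (proj₂ (proj₁ b) ⟨$⟩ʳ x))

record TFπIso {n} (Γ : Graph n) : Set where
  field
    φ        : AutTF Γ → Autπ Γ
    cong     : ∀ a b → _≈TF_ {Γ = Γ} a b → _≈π_ {Γ = Γ} (φ a) (φ b)
    hom      : ∀ a b c → IsProdTF {Γ = Γ} c a b → IsProdπ {Γ = Γ} (φ c) (φ a) (φ b)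
    injective : ∀ a b → _≈π_ {Γ = Γ} (φ a) (φ b) → _≈TF_ {Γ = Γ} a b
    surjective : ∀ y → ∃[ x ] (_≈π_ {Γ = Γ} (φ x) y)

-- A pair (π₁ , π₂) is in Aut^TF(Γ) exactly when π₁ maps each neighbourhood N(v)
-- onto N(π₂ v), by symmetry of E.  So the first component of a TF-pair is in
-- Aut^π(Γ); conversely an element π₁ of Aut^π(Γ) comes with a map σ sending v to
-- a vertex whose neighbourhood is π₁(N(v)).  In a reduced graph that vertex is
-- unique, so σ is injective, hence a permutation of the finite set V, and
-- (π₁ , σ) is a TF-pair.  Uniqueness also makes π₂ determined by π₁, so
-- (π₁ , π₂) ↦ π₁ is an isomorphism.
module Submission where

open import Defs
open import Data.Nat using (ℕ; suc)
open import Data.Nat.Properties using (≤-refl)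
open import Data.Product using (_×_; _,_; ∃-syntax; proj₁; proj₂)
open import Data.Fin using (Fin; punchOut)
open import Data.Fin.Properties using (any?; _≟_; punchOut-injective; <⇒notInjective)
open import Data.Fin.Permutation
  using (Permutation′; permutation; _⟨$⟩ʳ_; _⟨$⟩ˡ_; inverseʳ)
  renaming (_≈_ to _≈ₚ_)
open import Function.Bundles using (_⇔_; mk⇔; Equivalence; Injection)
open import Function.Properties.Inverse using (↔⇒↣)
open import Function.Construct.Composition using (_⇔-∘_)
open import Function.Construct.Symmetry using (⇔-sym)
open import Function.Definitions using (Injective)
open import Relation.Nullary using (yes; no)
open import Data.Empty using (⊥-elim)
open import Relation.Binary.PropositionalEquality
  using (_≡_; _≢_; refl; sym; trans; subst)

open Equivalence using (to; from)

injective⇒surjective : ∀ {n} {f : Fin n → Fin n} → Injective _≡_ _≡_ f →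
                        ∀ y → ∃[ x ] f x ≡ y
injective⇒surjective {suc m} {f} f-inj y with any? (λ x → f x ≟ y)
... | yes hit = hit
... | no y∉f = ⊥-elim (<⇒notInjective ≤-refl punchOut∘f-injective)
  where
  y≢f : ∀ x → y ≢ f x
  y≢f x eq = y∉f (x , sym eq)

  punchOut∘f-injective : Injective _≡_ _≡_ (λ x → punchOut (y≢f x))
  punchOut∘f-injective eq = f-inj (punchOut-injective (y≢f _) (y≢f _) eq)

injective⇒permutation : ∀ {n} (f : Fin n → Fin n) → Injective _≡_ _≡_ f → Permutation′ n
injective⇒permutation f f-inj =
  permutation f (λ y → proj₁ (surj y)) (λ y → proj₂ (surj y)) (λ x → f-inj (proj₂ (surj (f x))))
  where
  surj : ∀ y → ∃[ x ] f x ≡ y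
  surj = injective⇒surjective f-inj

module _ {n : ℕ} where

  ≐-sym : {S T : Subset n} → S ≐ T → T ≐ S
  ≐-sym S≐T u = ⇔-sym (S≐T u)

  ≐-trans : {S T U : Subset n} → S ≐ T → T ≐ U → S ≐ U
  ≐-trans S≐T T≐U u = T≐U u ⇔-∘ S≐T u

  ∈-image : (π : Permutation′ n) (S : Subset n) (x : Fin n) → image π S (π ⟨$⟩ʳ x) ⇔ S x
  ∈-image π S x = mk⇔ (λ { (x′ , s , πx′≡πx) → subst S (π-injective πx′≡πx) s })
                      (λ s → x , s , refl)
    where π-injective = Injection.injective (↔⇒↣ π)

  image-≐⇔ : (π : Permutation′ n) (S T : Subset n) →
             (image π S ≐ T) ⇔ (∀ x → S x ⇔ T (π ⟨$⟩ʳ x))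
  image-≐⇔ π S T = mk⇔
    (λ πS≐T x → πS≐T (π ⟨$⟩ʳ x) ⇔-∘ ⇔-sym (∈-image π S x))
    (λ S⇔Tπ u → mk⇔ (λ { (x , s , refl) → to (S⇔Tπ x) s })
                    (λ t → π ⟨$⟩ˡ u , from (S⇔Tπ (π ⟨$⟩ˡ u)) (subst T (sym (inverseʳ π)) t)
                                    , inverseʳ π))

  image-injective : (π : Permutation′ n) {S T : Subset n} → image π S ≐ image π T → S ≐ T
  image-injective π {S} {T} πS≐πT x = ∈-image π T x ⇔-∘ to (image-≐⇔ π S (image π T)) πS≐πT x

  image-cong : (π π′ : Permutation′ n) → π ≈ₚ π′ → (S : Subset n) → image π S ≐ image π′ S
  image-cong _ _ π≈π′ S u = mk⇔ (λ { (x , s , πx≡u) → x , s , trans (sym (π≈π′ x)) πx≡u })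
                                (λ { (x , s , π′x≡u) → x , s , trans (π≈π′ x) π′x≡u })

module _ {n : ℕ} (Γ : Graph n) where

  E-sym : ∀ {v w} → E Γ v w ⇔ E Γ w v
  E-sym {v} {w} = mk⇔ (trans (Graph.sym Γ w v)) (trans (Graph.sym Γ v w))

  IsAutTF⇔image-N : (π₁ π₂ : Permutation′ n) →
                    IsAutTF Γ (π₁ , π₂) ⇔ (∀ v → image π₁ (N Γ v) ≐ N Γ (π₂ ⟨$⟩ʳ v))
  IsAutTF⇔image-N π₁ π₂ = mk⇔
    (λ tf v → from (image-≐⇔ π₁ (N Γ v) (N Γ (π₂ ⟨$⟩ʳ v))) λ x → E-sym ⇔-∘ (tf x v ⇔-∘ E-sym))
    (λ πN≐N x v → E-sym ⇔-∘ (to (image-≐⇔ π₁ (N Γ v) (N Γ (π₂ ⟨$⟩ʳ v))) (πN≐N v) x ⇔-∘ E-sym))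

  IsAutTF⇒IsAutπ : (π₁ π₂ : Permutation′ n) → IsAutTF Γ (π₁ , π₂) → IsAutπ Γ π₁
  IsAutTF⇒IsAutπ π₁ π₂ tf v = π₂ ⟨$⟩ʳ v , to (IsAutTF⇔image-N π₁ π₂) tf v

  module _ (reduced : Reduced Γ) where

    ≐-N-unique : ∀ {S : Subset n} {w w′} → S ≐ N Γ w → S ≐ N Γ w′ → w ≡ w′
    ≐-N-unique S≐Nw S≐Nw′ = reduced _ _ (≐-trans (≐-sym S≐Nw) S≐Nw′)

    IsAutTF-unique : (π₁ π₂ π₁′ π₂′ : Permutation′ n) → π₁ ≈ₚ π₁′ →
                     IsAutTF Γ (π₁ , π₂) → IsAutTF Γ (π₁′ , π₂′) → π₂ ≈ₚ π₂′
    IsAutTF-unique π₁ π₂ π₁′ π₂′ π₁≈π₁′ tf tf′ v = ≐-N-unique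
      (to (IsAutTF⇔image-N π₁ π₂) tf v)
      (≐-trans (image-cong π₁ π₁′ π₁≈π₁′ (N Γ v)) (to (IsAutTF⇔image-N π₁′ π₂′) tf′ v))

    IsAutπ⇒IsAutTF : (π₁ : Permutation′ n) → IsAutπ Γ π₁ → ∃[ π₂ ] IsAutTF Γ (π₁ , π₂)
    IsAutπ⇒IsAutTF π₁ aut = π₂ , from (IsAutTF⇔image-N π₁ π₂) image-N≐N-σ
      where
      σ : Fin n → Fin n
      σ v = proj₁ (aut v)

      image-N≐N-σ : ∀ v → image π₁ (N Γ v) ≐ N Γ (σ v)
      image-N≐N-σ v = proj₂ (aut v)

      σ-injective : Injective _≡_ _≡_ σ
      σ-injective {v} {v′} σv≡σv′ = reduced v v′ (image-injective π₁
        (≐-trans (image-N≐N-σ v)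
          (subst (λ w → N Γ w ≐ image π₁ (N Γ v′)) (sym σv≡σv′) (≐-sym (image-N≐N-σ v′)))))

      π₂ : Permutation′ n
      π₂ = injective⇒permutation σ σ-injective

    AutTF≅Autπ : TFπIso Γ
    AutTF≅Autπ = record
      { φ          = λ { ((π₁ , π₂) , tf) → π₁ , IsAutTF⇒IsAutπ π₁ π₂ tf }
      ; cong       = λ _ _ → proj₁
      ; hom        = λ _ _ _ → proj₁
      ; injective  = λ { ((π₁ , π₂) , tf) ((π₁′ , π₂′) , tf′) π₁≈π₁′ →
                         π₁≈π₁′ , IsAutTF-unique π₁ π₂ π₁′ π₂′ π₁≈π₁′ tf tf′ }
      ; surjective = λ { (π₁ , aut) → let (π₂ , tf) = IsAutπ⇒IsAutTF π₁ aut
                                       in ((π₁ , π₂) , tf) , λ _ → refl }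
      }

proposition1p6 : ∀ {n : ℕ} (Γ : Graph n) → Reduced Γ →
    TFπIso Γ × (∀ (π₁ : Permutation′ n) → IsAutπ Γ π₁ ⇔ (∃[ π₂ ] IsAutTF Γ (π₁ , π₂)))
proposition1p6 Γ reduced = AutTF≅Autπ Γ reduced , λ π₁ →
  mk⇔ (IsAutπ⇒IsAutTF Γ reduced π₁) (λ { (π₂ , tf) → IsAutTF⇒IsAutπ Γ π₁ π₂ tf })
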